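{- Fix $k\ge 4$, let $G$ be a graph and let $\mathcal{P}$ be the collection of paths returned by the algorithm Approx1 on $G$. Then for every path $P\in\mathcal{P}$ and every valid index $j$, $n(u_j)\le j$ and $n(v_j)\le j$.
   Context: The order of a path is its number of vertices. $V(\mathcal{P})$ is the union of the vertex sets of the paths in $\mathcal{P}$. Vertex naming on a path $P$ of order $\ell$: choose an endpoint; $u_j$ is the vertex at distance $j$ from it ($0\le j\le\lceil\ell/2\rceil-1$), $v_j$ the vertex at distance $j$ from the other endpoint ($0\le j\le\lfloor\ell/2\rfloor-1$); either endpoint may be $u_0$. For $v\in V(\mathcal{P})$, an extension $e(v)$ is a path in $G[V\setminus V(\mathcal{P})]$ with an endpoint adjacent to $v$ (the empty path of order 0 is allowed); $n(e(v))$ denotes its order, and $n(v)$ is the maximum order of an extension at $v$. Operations: (Add) if $G[V\setminus V(\mathcal{P})]$ has a $k$-path, add it. (Rep) if for $P\in\mathcal{P}$ there are $t$ and $e(u_t)$ with $n(e(u_t))\ge t+1$, replace the prefix $u_0$-$\cdots$-$u_{t-1}$ by $e(u_t)$ (symmetrically for $v_t$). (DoubleRep) for $P\in\mathcal{P}$: (i) if there are $t$, $j\ge t+1$ and vertex-disjoint $e(u_t),e(u_j)$ with $n(e(u_t))\ge k-t-1$, $n(e(u_j))\ge k-(n(P)-j)$, replace $P$ by $u_0$-$\cdots$-$u_t$-$e(u_t)$ and $e(u_j)$-$u_j$-$\cdots$-$v_0$; (ii) if there are $t,j$ and vertex-disjoint $e(u_t),e(v_j)$ with $n(e(u_t))\ge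 k-t-1$, $n(e(v_j))\ge k-j-1$, replace $P$ by $u_0$-$\cdots$-$u_t$-$e(u_t)$ and $e(v_j)$-$v_j$-$\cdots$-$v_0$. Algorithm Approx1: start with $\mathcal{P}=\emptyset$; while one of Add, Rep, DoubleRep is applicable, apply it and then break every path of order at least $2k$ into two paths one of which is a $k$-path; return $\mathcal{P}$ when none applies. -}

module Defs where

open import Data.Nat using (ℕ; zero; suc; _+_; _*_; _∸_; _≤_; _<_; _≥_; ⌈_/2⌉; ⌊_/2⌋)
open import Data.Fin using (Fin)
open import Data.Bool using (Bool; false; T)
open import Data.Unit using (⊤)
open import Data.List using (List; []; _∷_; length; reverse; take; drop; _++_; concat)
open import Data.List.Membership.Propositional using (_∈_; _∉_)
open import Data.List.Relation.Unary.All using (All)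
open import Data.List.Relation.Unary.Linked using (Linked)
open import Data.List.Relation.Unary.Unique.Propositional using (Unique)
open import Data.Product using (Σ; ∃; _×_; _,_)
open import Data.Sum using (_⊎_)
open import Relation.Binary.PropositionalEquality using (_≡_)
open import Relation.Binary.Construct.Closure.ReflexiveTransitive using (Star)
open import Relation.Nullary using (¬_)

record Graph : Set where
  field
    N      : ℕ
    adj    : Fin N → Fin N → Bool
    sym    : ∀ x y → adj x y ≡ adj y x
    irrefl : ∀ x → adj x x ≡ false

module _ (G : Graph) where
  open Graph G

  Vertex : Set
  Vertex = Fin N

  Adj : Vertex → Vertex → Set
  Adj x y = T (adj x y)

  -- A path is a list of distinct vertices, consecutive ones adjacent.
  -- Its order is its length.  (The empty list is the empty path of order 0.)
  IsPath : List Vertex → Set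
  IsPath p = Linked Adj p × Unique p

  VP : List (List Vertex) → List Vertex
  VP 𝒫 = concat 𝒫

  PathOutside : List (List Vertex) → List Vertex → Set
  PathOutside 𝒫 p = IsPath p × All (λ x → x ∉ VP 𝒫) p

  AttachedAt : Vertex → List Vertex → Set
  AttachedAt v []      = ⊤
  AttachedAt v (x ∷ _) = Adj v x

  -- e is an extension e(v) at v (w.r.t. 𝒫); its order is length e.
  -- Convention: the head of the list e is the endpoint adjacent to v.
  Extension : List (List Vertex) → Vertex → List Vertex → Set
  Extension 𝒫 v e = PathOutside 𝒫 e × AttachedAt v e

  -- vertex naming on a path Q (listed starting from the chosen endpoint u_0)
  UAt : List Vertex → ℕ → Vertex → Set
  UAt Q j x = j < ⌈ length Q /2⌉ × ∃ λ rest → drop j Q ≡ x ∷ rest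

  VAt : List Vertex → ℕ → Vertex → Set
  VAt Q j x = j < ⌊ length Q /2⌋ × ∃ λ rest → drop j (reverse Q) ≡ x ∷ rest

  -- Q is P read from one of its two endpoints (either endpoint may be u_0)
  Oriented : List Vertex → List Vertex → Set
  Oriented P Q = Q ≡ P ⊎ Q ≡ reverse P

  Disjoint : List Vertex → List Vertex → Set
  Disjoint e₁ e₂ = All (λ x → x ∉ e₂) e₁

  -- One application of Add, Rep or DoubleRep (the symmetric v-version of Rep
  -- is covered by choosing the orientation Q of P).
  data Op (k : ℕ) (𝒫 : List (List Vertex)) : List (List Vertex) → Set where
    add : ∀ p → PathOutside 𝒫 p → length p ≡ k → Op k 𝒫 (p ∷ 𝒫)
    rep : ∀ A P B Q t x e →
          𝒫 ≡ A ++ P ∷ B → Oriented P Q →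
          UAt Q t x → Extension 𝒫 x e → length e ≥ suc t →
          Op k 𝒫 (A ++ (reverse e ++ drop t Q) ∷ B)
    doubleRep₁ : ∀ A P B Q t j x y e₁ e₂ →
          𝒫 ≡ A ++ P ∷ B → Oriented P Q →
          UAt Q t x → UAt Q j y → j ≥ suc t →
          Extension 𝒫 x e₁ → Extension 𝒫 y e₂ → Disjoint e₁ e₂ →
          length e₁ ≥ k ∸ t ∸ 1 → length e₂ ≥ k ∸ (length Q ∸ j) →
          Op k 𝒫 (A ++ (take (suc t) Q ++ e₁) ∷ (reverse e₂ ++ drop j Q) ∷ B)
    doubleRep₂ : ∀ A P B Q t j x y e₁ e₂ →
          𝒫 ≡ A ++ P ∷ B → Oriented P Q →
          UAt Q t x → VAt Q j y →
          Extension 𝒫 x e₁ → Extension 𝒫 y e₂ → Disjoint e₁ e₂ →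
          length e₁ ≥ k ∸ t ∸ 1 → length e₂ ≥ k ∸ j ∸ 1 →
          Op k 𝒫 (A ++ (take (suc t) Q ++ e₁) ∷ (reverse e₂ ++ drop (length Q ∸ suc j) Q) ∷ B)

  data BreakStep (k : ℕ) (𝒫 : List (List Vertex)) : List (List Vertex) → Set where
    break : ∀ A P B Q → 𝒫 ≡ A ++ P ∷ B → length P ≥ 2 * k → Oriented P Q →
            BreakStep k 𝒫 (A ++ take k Q ∷ drop k Q ∷ B)

  AllShort : ℕ → List (List Vertex) → Set
  AllShort k 𝒫 = All (λ p → length p < 2 * k) 𝒫

  -- One iteration of the while-loop of Approx1: apply an operation, then break
  -- paths until every path has order < 2k.
  Iter : ℕ → List (List Vertex) → List (List Vertex) → Set
  Iter k 𝒫 𝒫'' = ∃ λ 𝒫' → Op k 𝒫 𝒫' × Star (BreakStep k) 𝒫' 𝒫'' × AllShort k 𝒫''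

  -- 𝒫 is a possible output of Approx1 on G (any run, any choices).
  ReturnedByApprox1 : ℕ → List (List Vertex) → Set
  ReturnedByApprox1 k 𝒫 = Star (Iter k) [] 𝒫 × (∀ 𝒫' → ¬ Op k 𝒫 𝒫')

-- If some vertex u_j had an extension of order ≥ j + 1, the operation Rep
-- would still be applicable, contradicting that Approx1 has stopped; a vertex
-- v_j of Q is the vertex u_j of the reversed orientation of the same path.
module Submission where

open import Defs
open import Data.Nat using (ℕ; _≤_; _<_; _≤?_; ⌊_/2⌋; ⌈_/2⌉)
open import Data.Nat.Properties using (≰⇒>; ⌊n/2⌋≤⌈n/2⌉; <-≤-trans)
open import Data.List using (List; length; reverse)
open import Data.List.Properties using (reverse-involutive; length-reverse)
open import Data.List.Membership.Propositional using (_∈_)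
open import Data.List.Membership.Propositional.Properties using (∈-∃++)
open import Data.Product using (∃; _×_; _,_)
open import Data.Sum using (_⊎_; inj₁; inj₂)
open import Relation.Nullary using (¬_; yes; no; contradiction)
open import Relation.Binary.PropositionalEquality using (refl; sym; subst)

module _ (G : Graph) where

  Oriented-reverse : ∀ {P Q} → Oriented G P Q → Oriented G P (reverse Q)
  Oriented-reverse (inj₁ refl) = inj₂ refl
  Oriented-reverse {P} (inj₂ refl) = inj₁ (reverse-involutive P)

  ⌊length/2⌋≤⌈length-reverse/2⌉ : (Q : List (Vertex G)) →
    ⌊ length Q /2⌋ ≤ ⌈ length (reverse Q) /2⌉
  ⌊length/2⌋≤⌈length-reverse/2⌉ Q =
    subst (λ n → ⌊ length Q /2⌋ ≤ ⌈ n /2⌉) (sym (length-reverse Q)) (⌊n/2⌋≤⌈n/2⌉ (length Q))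

  VAt⇒UAt-reverse : ∀ Q {j x} → VAt G Q j x → UAt G (reverse Q) j x
  VAt⇒UAt-reverse Q (j<⌊ℓ/2⌋ , rest , eq) =
    <-≤-trans j<⌊ℓ/2⌋ (⌊length/2⌋≤⌈length-reverse/2⌉ Q) , rest , eq

  UAt-in-some-orientation : ∀ {P Q j x} → Oriented G P Q → UAt G Q j x ⊎ VAt G Q j x →
    ∃ λ Q′ → Oriented G P Q′ × UAt G Q′ j x
  UAt-in-some-orientation {Q = Q} o (inj₁ u) = Q , o , u
  UAt-in-some-orientation {Q = Q} o (inj₂ v) =
    reverse Q , Oriented-reverse o , VAt⇒UAt-reverse Q v

  rep-applicable : ∀ k 𝒫 {P Q j x e} → P ∈ 𝒫 → Oriented G P Q → UAt G Q j x →
    Extension G 𝒫 x e → j < length e → ∃ (Op G k 𝒫)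
  rep-applicable k 𝒫 {P} {Q} {j} {x} {e} P∈𝒫 o u ext j<|e| with ∈-∃++ P∈𝒫
  ... | A , B , 𝒫≡A++P∷B = _ , rep A P B Q j x e 𝒫≡A++P∷B o u ext j<|e|

  terminal⇒extension-short : ∀ k 𝒫 → (∀ 𝒫′ → ¬ Op G k 𝒫 𝒫′) →
    ∀ {P Q j x e} → P ∈ 𝒫 → Oriented G P Q → UAt G Q j x ⊎ VAt G Q j x →
    Extension G 𝒫 x e → length e ≤ j
  terminal⇒extension-short k 𝒫 terminal {j = j} {e = e} P∈𝒫 o uv ext with length e ≤? j
  ... | yes |e|≤j = |e|≤j
  ... | no |e|≰j with UAt-in-some-orientation o uv
  ...   | Q′ , o′ , u with rep-applicable k 𝒫 P∈𝒫 o′ u ext (≰⇒> |e|≰j)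
  ...     | 𝒫′ , op = contradiction op (terminal 𝒫′)

lemma4 : (k : ℕ) → 4 ≤ k → (G : Graph) → (𝒫 : List (List (Vertex G))) →
    ReturnedByApprox1 G k 𝒫 →
    ∀ P → P ∈ 𝒫 → ∀ Q → Oriented G P Q →
    ∀ j x → (UAt G Q j x ⊎ VAt G Q j x) →
    ∀ e → Extension G 𝒫 x e → length e ≤ j
lemma4 k _ G 𝒫 (_ , terminal) P P∈𝒫 Q o j x uv e ext =
  terminal⇒extension-short G k 𝒫 terminal P∈𝒫 o uv ext
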